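{- For every oracle recursive function $f\in\mathcal{OR}$ with $f:\mathbb{N}^m\times\mathbb{B}^{\mathbb{N}}\rightharpoonup\mathbb{N}$ and all $x_1,\dots,x_m,y\in\mathbb{N}$, the set $f^*(x_1,\dots,x_m,y)=\{\omega\in\mathbb{B}^{\mathbb{N}}\mid f(x_1,\dots,x_m,\omega)=y\}$ is measurable, i.e. belongs to the $\sigma$-algebra generated by the cylinders.
   Context: $\mathbb{B}=\{0,1\}$. For $X\subseteq\mathbb{B}^n$, the $n$-cylinder is $\{s\cdot\omega\mid s\in X,\omega\in\mathbb{B}^{\mathbb{N}}\}$; the relevant $\sigma$-algebra is the one generated by all cylinders. $\mathcal{OR}$ is the smallest class of partial functions $\mathbb{N}^n\times\mathbb{B}^{\mathbb{N}}\rightharpoonup\mathbb{N}$ containing the zero function $(\vec x,\omega)\mapsto0$, successor $(x,\omega)\mapsto x+1$, projections $(x_1,\dots,x_k,\omega)\mapsto x_i$, and the query function $q(x,\omega)=\omega(x)$, and closed under composition $f(\vec x,\omega)=h(g_1(\vec x,\omega),\dots,g_n(\vec x,\omega),\omega)$, primitive recursion $f(0,\vec x,\omega)=h(\vec x,\omega)$, $f(x+1,\vec x,\omega)=g(f(x,\vec x,\omega),x,\vec x,\omega)$, and minimization $f(\vec x,\omega)=\mu x.(g(\vec x,x,\omega)=0)$ (the oracle $\omega$ passed unchanged). -}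

module Defs where

open import Data.Nat using (ℕ; zero; suc; _<_)
open import Data.Bool using (Bool; true; false)
open import Data.Fin using (Fin; toℕ)
open import Data.Vec using (Vec; []; _∷_; lookup; tabulate; _∷ʳ_)
open import Data.Product using (Σ; ∃; _×_; _,_)
open import Relation.Nullary using (¬_)

Oracle : Set
Oracle = ℕ → Bool

OSet : Set₁
OSet = Oracle → Set

prefix : (n : ℕ) → Oracle → Vec Bool n
prefix n ω = tabulate (λ i → ω (toℕ i))

-- The n-cylinder over X ⊆ 𝔹^n : { s·ω | s ∈ X }, i.e. all ω whose prefix lies in X.
cylinder : (n : ℕ) → (Vec Bool n → Set) → OSet
cylinder n X ω = X (prefix n ω)

data Measurable : OSet → Set₁ where
  cyl   : (n : ℕ) (X : Vec Bool n → Set) → Measurable (cylinder n X)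
  compl : {A : OSet} → Measurable A → Measurable (λ ω → ¬ A ω)
  union : (A : ℕ → OSet) → ((i : ℕ) → Measurable (A i)) →
          Measurable (λ ω → ∃ λ i → A i ω)
  ext   : {A B : OSet} → Measurable A →
          ((ω : Oracle) → (A ω → B ω) × (B ω → A ω)) → Measurable B

-- Syntax of oracle recursive functions of arity n (oracle argument implicit).
data OR : ℕ → Set where
  Z     : (n : ℕ) → OR n
  S     : OR 1
  P     : (k : ℕ) → Fin k → OR k
  Q     : OR 1
  comp  : {m n : ℕ} → OR n → Vec (OR m) n → OR m
  prec  : {n : ℕ} → OR n → OR (suc (suc n)) → OR (suc n)
  mu    : {n : ℕ} → OR (suc n) → OR n

bit : Bool → ℕ
bit false = 0
bit true  = 1

-- Big-step semantics: Eval f xs ω y  means  f(xs, ω) is defined and equals y.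
mutual
  data Eval : {n : ℕ} → OR n → Vec ℕ n → Oracle → ℕ → Set where
    eZ    : ∀ {n} {xs : Vec ℕ n} {ω} → Eval (Z n) xs ω 0
    eS    : ∀ {x ω} → Eval S (x ∷ []) ω (suc x)
    eP    : ∀ {k} {i : Fin k} {xs ω} → Eval (P k i) xs ω (lookup xs i)
    eQ    : ∀ {x ω} → Eval Q (x ∷ []) ω (bit (ω x))
    eComp : ∀ {m n} {h : OR n} {gs : Vec (OR m) n} {xs ω} {zs : Vec ℕ n} {y} →
            EvalAll gs xs ω zs → Eval h zs ω y → Eval (comp h gs) xs ω y
    ePrec0 : ∀ {n} {h : OR n} {g} {xs ω y} →
             Eval h xs ω y → Eval (prec h g) (0 ∷ xs) ω y
    ePrecS : ∀ {n} {h : OR n} {g} {x xs ω z y} →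
             Eval (prec h g) (x ∷ xs) ω z → Eval g (z ∷ x ∷ xs) ω y →
             Eval (prec h g) (suc x ∷ xs) ω y
    eMu   : ∀ {n} {g : OR (suc n)} {xs : Vec ℕ n} {ω y} →
            Eval g (xs ∷ʳ y) ω 0 →
            ((k : ℕ) → k < y → ∃ λ v → Eval g (xs ∷ʳ k) ω (suc v)) →
            Eval (mu g) xs ω y

  data EvalAll {m : ℕ} : {n : ℕ} → Vec (OR m) n → Vec ℕ m → Oracle → Vec ℕ n → Set where
    [] : ∀ {xs ω} → EvalAll [] xs ω []
    _∷_ : ∀ {n} {g : OR m} {gs : Vec (OR m) n} {xs ω z zs} →
          Eval g xs ω z → EvalAll gs xs ω zs → EvalAll (g ∷ gs) xs ω (z ∷ zs)

preimage : {m : ℕ} → OR m → Vec ℕ m → ℕ → OSet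
preimage f xs y ω = Eval f xs ω y

{-# OPTIONS --safe #-}
-- A terminating oracle computation queries only finitely many bits of its
-- oracle, so f(x⃗, ω) = y persists on a whole cylinder around ω: the set
-- f*(x⃗, y) is open in Cantor space. An open set is the union over n of the
-- n-cylinders it contains, hence measurable.
module Submission where

open import Defs
open import Data.Nat using (ℕ; zero; suc; _<_; _≤_; _⊔_)
open import Data.Nat.Properties using (m≤m⊔n; m≤n⊔m; <-≤-trans; n<1+n; m<n⇒m<1+n; m<1+n⇒m<n∨m≡n)
open import Data.Bool using (Bool)
open import Data.Vec using (Vec; []; _∷_; lookup; _∷ʳ_)
open import Data.Vec.Properties using (lookup∘tabulate)
open import Data.Fin using (toℕ; fromℕ<)
open import Data.Fin.Properties using (toℕ-fromℕ<)
open import Data.Product using (∃; _×_; _,_)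
open import Data.Sum using (inj₁; inj₂)
open import Relation.Binary.PropositionalEquality using (_≡_; refl; sym; cong; subst; module ≡-Reasoning)

AgreeBelow : ℕ → Oracle → Oracle → Set
AgreeBelow n ω ω′ = ∀ i → i < n → ω i ≡ ω′ i

AgreeBelow-mono : ∀ {m n ω ω′} → m ≤ n → AgreeBelow n ω ω′ → AgreeBelow m ω ω′
AgreeBelow-mono m≤n agree i i<m = agree i (<-≤-trans i<m m≤n)

prefix-≡⇒AgreeBelow : ∀ n {ω ω′} → prefix n ω ≡ prefix n ω′ → AgreeBelow n ω ω′
prefix-≡⇒AgreeBelow n {ω} {ω′} eq i i<n = begin
  ω i                            ≡⟨ cong ω (sym (toℕ-fromℕ< i<n)) ⟩
  ω (toℕ j)                      ≡⟨ sym (lookup∘tabulate _ j) ⟩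
  lookup (prefix n ω) j          ≡⟨ cong (λ s → lookup s j) eq ⟩
  lookup (prefix n ω′) j         ≡⟨ lookup∘tabulate _ j ⟩
  ω′ (toℕ j)                     ≡⟨ cong ω′ (toℕ-fromℕ< i<n) ⟩
  ω′ i                           ∎
  where
  open ≡-Reasoning
  j = fromℕ< i<n

Interior : OSet → OSet
Interior A ω = ∃ λ n → ∀ ω′ → AgreeBelow n ω ω′ → A ω′

Open : OSet → Set
Open A = ∀ ω → A ω → Interior A ω

interior-universal : {A : OSet} → (∀ ω → A ω) → ∀ {ω} → Interior A ω
interior-universal all = 0 , λ ω′ _ → all ω′

interior-map : {A B : OSet} → (∀ {ω} → A ω → B ω) → ∀ {ω} → Interior A ω → Interior B ω
interior-map A⊆B (n , inside) = n , λ ω′ agree → A⊆B (inside ω′ agree)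

interior-pair : {A B : OSet} → ∀ {ω} → Interior A ω → Interior B ω →
                Interior (λ ω′ → A ω′ × B ω′) ω
interior-pair (m , inA) (n , inB) = m ⊔ n , λ ω′ agree →
  inA ω′ (AgreeBelow-mono (m≤m⊔n m n) agree) , inB ω′ (AgreeBelow-mono (m≤n⊔m m n) agree)

open⇒measurable : {A : OSet} → Open A → Measurable A
open⇒measurable {A} open-A = ext (union (λ n → cylinder n (Inside n)) (λ n → cyl n (Inside n)))
  λ ω → (λ { (n , inside) → inside ω refl })
      , λ a → let (n , inside) = open-A ω a in
              n , λ ω′ eq → inside ω′ (prefix-≡⇒AgreeBelow n (sym eq))
  where
  Inside : (n : ℕ) → Vec Bool n → Set
  Inside n s = ∀ ω′ → prefix n ω′ ≡ s → A ω′

evalAll-preimage : {m k : ℕ} → Vec (OR m) k → Vec ℕ m → Vec ℕ k → OSet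
evalAll-preimage gs xs zs ω = EvalAll gs xs ω zs

PositiveBelow : {n : ℕ} → OR (suc n) → Vec ℕ n → ℕ → OSet
PositiveBelow g xs y ω = ∀ k → k < y → ∃ λ v → Eval g (xs ∷ʳ k) ω (suc v)

mutual
  eval-interior : ∀ {m} {f : OR m} {xs ω y} → Eval f xs ω y → Interior (preimage f xs y) ω
  eval-interior eZ = interior-universal λ _ → eZ
  eval-interior eS = interior-universal λ _ → eS
  eval-interior eP = interior-universal λ _ → eP
  eval-interior (eQ {x} {ω}) = suc x , λ ω′ agree →
    subst (λ b → Eval Q (x ∷ []) ω′ (bit b)) (sym (agree x (n<1+n x))) eQ
  eval-interior (eComp gs h) =
    interior-map (λ (gs′ , h′) → eComp gs′ h′) (interior-pair (evalAll-interior gs) (eval-interior h))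
  eval-interior (ePrec0 h) = interior-map ePrec0 (eval-interior h)
  eval-interior (ePrecS f g) =
    interior-map (λ (f′ , g′) → ePrecS f′ g′) (interior-pair (eval-interior f) (eval-interior g))
  eval-interior (eMu {y = y} root below) =
    interior-map (λ (root′ , below′) → eMu root′ below′)
      (interior-pair (eval-interior root) (positiveBelow-interior y below))

  evalAll-interior : ∀ {m k} {gs : Vec (OR m) k} {xs ω zs} →
                     EvalAll gs xs ω zs → Interior (evalAll-preimage gs xs zs) ω
  evalAll-interior [] = interior-universal λ _ → []
  evalAll-interior (g ∷ gs) =
    interior-map (λ (g′ , gs′) → g′ ∷ gs′) (interior-pair (eval-interior g) (evalAll-interior gs))

  positiveBelow-interior : ∀ {n} {g : OR (suc n)} {xs ω} (y : ℕ) →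
                           PositiveBelow g xs y ω → Interior (PositiveBelow g xs y) ω
  positiveBelow-interior zero _ = interior-universal λ _ _ ()
  positiveBelow-interior {g = g} {xs} (suc y) below with below y (n<1+n y)
  ... | v , gy = interior-map extend
        (interior-pair (positiveBelow-interior y (λ k k<y → below k (m<n⇒m<1+n k<y)))
                       (eval-interior gy))
    where
    extend : ∀ {ω′} → PositiveBelow g xs y ω′ × Eval g (xs ∷ʳ y) ω′ (suc v) →
             PositiveBelow g xs (suc y) ω′
    extend (below′ , gy′) k k<1+y with m<1+n⇒m<n∨m≡n k<1+y
    ... | inj₁ k<y  = below′ k k<y
    ... | inj₂ refl = v , gy′

lemma2 : {m : ℕ} (f : OR m) (xs : Vec ℕ m) (y : ℕ) → Measurable (preimage f xs y)
lemma2 f xs y = open⇒measurable λ _ → eval-interior
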